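{- Let $G$ be a finite group. (1) If $G$ is semi-rational, then $Z(G)$ is semi-rational. (2) If $G$ is inverse semi-rational, then $Z(G)$ is inverse semi-rational. (3) If $G$ is rational, then $Z(G)$ is rational.
   Context: For a finite group $H$ with exponent $m$, for $g\in H$ let $\operatorname{Atom}(g)=\{g^k:\gcd(k,o(g))=1\}$ and $C_g$ the conjugacy class of $g$ in $H$. $H$ is semi-rational if for every $g\in H$ there is $r_g\in\mathbb{Z}_m^*$ with $\operatorname{Atom}(g)\subseteq C_g\cup C_{g^{r_g}}$; inverse semi-rational if $\operatorname{Atom}(g)\subseteq C_g\cup C_{g^{ -1}}$ for every $g\in H$; rational if $\chi(g)\in\mathbb{Q}$ for every irreducible complex character $\chi$ of $H$ and every $g\in H$ (equivalently $\operatorname{Atom}(g)\subseteq C_g$ for all $g$). Here $Z(G)$ is regarded as a group in its own right. -}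

module Defs where

open import Level using (Level; _⊔_)
open import Data.Nat using (ℕ; zero; suc; _<_)
open import Data.Nat.Coprimality using (Coprime)
open import Data.Fin using (Fin)
open import Data.Product using (Σ; Σ-syntax; ∃; ∃-syntax; _×_; _,_; proj₁; proj₂)
open import Data.Sum using (_⊎_)
open import Relation.Nullary using (¬_)
open import Algebra.Bundles using (Group)
open import Algebra.Structures using (IsGroup; IsMonoid; IsSemigroup; IsMagma)
import Algebra.Properties.Group as GP
import Relation.Binary.Reasoning.Setoid as SetoidReasoning

module _ {c ℓ : Level} (G : Group c ℓ) where
  open Group G

  pow : Carrier → ℕ → Carrier
  pow g zero    = ε
  pow g (suc k) = g ∙ pow g k

  IsFinite : Set (c ⊔ ℓ)
  IsFinite = Σ[ n ∈ ℕ ] Σ[ e ∈ (Fin n → Carrier) ] (∀ x → ∃[ i ] e i ≈ x)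

  IsOrder : Carrier → ℕ → Set ℓ
  IsOrder g o = 0 < o × pow g o ≈ ε × (∀ j → 0 < j → j < o → ¬ (pow g j ≈ ε))

  IsExponent : ℕ → Set (c ⊔ ℓ)
  IsExponent m = 0 < m × (∀ g → pow g m ≈ ε)
               × (∀ j → 0 < j → j < m → ¬ (∀ g → pow g j ≈ ε))

  Conj : Carrier → Carrier → Set (c ⊔ ℓ)
  Conj x y = ∃[ h ] (h ∙ x ∙ h ⁻¹ ≈ y)

  -- Atom(g) ⊆ C_g ∪ C_y, where Atom(g) = { g^k : gcd(k, o(g)) = 1 }
  -- (k ranges over ℕ; enough since g^k depends only on k mod o(g))
  AtomWithin : Carrier → Carrier → Set (c ⊔ ℓ)
  AtomWithin g y = ∀ o → IsOrder g o → ∀ k → Coprime k o →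
                   Conj g (pow g k) ⊎ Conj y (pow g k)

  SemiRational : Set (c ⊔ ℓ)
  SemiRational = ∀ m → IsExponent m → ∀ g →
                 ∃[ r ] (Coprime r m × AtomWithin g (pow g r))

  InverseSemiRational : Set (c ⊔ ℓ)
  InverseSemiRational = ∀ g → AtomWithin g (g ⁻¹)

  -- rationality via its stated equivalent: Atom(g) ⊆ C_g for all g
  Rational : Set (c ⊔ ℓ)
  Rational = ∀ g → ∀ o → IsOrder g o → ∀ k → Coprime k o → Conj g (pow g k)

  IsCentral : Carrier → Set (c ⊔ ℓ)
  IsCentral z = ∀ x → z ∙ x ≈ x ∙ z

  private
    open SetoidReasoning setoid
    open GP G using (⁻¹-anti-homo-∙; ⁻¹-involutive)

    ZC : Set (c ⊔ ℓ)
    ZC = Σ Carrier IsCentral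

    _≈Z_ : ZC → ZC → Set ℓ
    a ≈Z b = proj₁ a ≈ proj₁ b

    _∙Z_ : ZC → ZC → ZC
    (a , pa) ∙Z (b , pb) = a ∙ b , λ x → begin
      (a ∙ b) ∙ x ≈⟨ assoc a b x ⟩
      a ∙ (b ∙ x) ≈⟨ ∙-congˡ (pb x) ⟩
      a ∙ (x ∙ b) ≈⟨ sym (assoc a x b) ⟩
      (a ∙ x) ∙ b ≈⟨ ∙-congʳ (pa x) ⟩
      (x ∙ a) ∙ b ≈⟨ assoc x a b ⟩
      x ∙ (a ∙ b) ∎

    εZ : ZC
    εZ = ε , λ x → trans (identityˡ x) (sym (identityʳ x))

    _⁻¹Z : ZC → ZC
    (a , pa) ⁻¹Z = a ⁻¹ , λ x → begin
      a ⁻¹ ∙ x              ≈⟨ ∙-congˡ (sym (⁻¹-involutive x)) ⟩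
      a ⁻¹ ∙ (x ⁻¹) ⁻¹      ≈⟨ sym (⁻¹-anti-homo-∙ (x ⁻¹) a) ⟩
      (x ⁻¹ ∙ a) ⁻¹         ≈⟨ ⁻¹-cong (sym (pa (x ⁻¹))) ⟩
      (a ∙ x ⁻¹) ⁻¹         ≈⟨ ⁻¹-anti-homo-∙ a (x ⁻¹) ⟩
      (x ⁻¹) ⁻¹ ∙ a ⁻¹      ≈⟨ ∙-congʳ (⁻¹-involutive x) ⟩
      x ∙ a ⁻¹ ∎

    isGroupZ : IsGroup _≈Z_ _∙Z_ εZ _⁻¹Z
    isGroupZ = record
      { isMonoid = record
        { isSemigroup = record
          { isMagma = record
            { isEquivalence = record { refl = refl ; sym = sym ; trans = trans }
            ; ∙-cong = ∙-cong }
          ; assoc = λ x y z → assoc (proj₁ x) (proj₁ y) (proj₁ z) }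
        ; identity = (λ x → identityˡ (proj₁ x)) , (λ x → identityʳ (proj₁ x)) }
      ; inverse = (λ x → inverseˡ (proj₁ x)) , (λ x → inverseʳ (proj₁ x))
      ; ⁻¹-cong = ⁻¹-cong }

  Centre : Group (c ⊔ ℓ) ℓ
  Centre = record { isGroup = isGroupZ }

-- A central element is conjugate only to itself, so the atom conditions of G read at a
-- central element are equalities, and these hold verbatim in Z(G); this gives (2) and (3).
-- For (1), semi-rationality confines the atoms of a central x of order o to the two values
-- x and x^r.  Since x^(o-1) = x⁻¹ is itself an atom and x^0, …, x^(o-1) are distinct, this
-- forces Atom(x) ⊆ {x, x⁻¹}; and an inverse semi-rational group is semi-rational with
-- r = m - 1.  Without decidable equality in G its exponent exists only up to double
-- negation, which suffices because the residue of k mod o that it pins down is decidable.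
module Submission where

open import Defs
open import Level using (Level)
open import Data.Product using (_×_; ∃; ∃-syntax; _,_; proj₁; proj₂)
open import Data.Sum using (_⊎_; inj₁; inj₂)
import Data.Sum as Sum
open import Data.Fin using (toℕ)
open import Data.Fin.Properties using (pigeonhole; toℕ≤pred[n])
open import Data.Nat using (ℕ; zero; suc; _+_; _*_; _∸_; _<_; _≤_; _%_; _/_; _!; NonZero; z≤n; s≤s)
open import Data.Nat.Properties
  using (_≟_; ≤-trans; ≤-<-trans; <⇒≤; n<1+n; <-cmp; m<1+n⇒m<n∨m≡n; m∸n≤m; m<n⇒0<n∸m;
         m+[n∸m]≡n; +-comm; 1≤n!)
open import Data.Nat.DivMod using (m≡m%n+[m/n]*n; m%n<n; n%1≡0)
open import Data.Nat.Divisibility using (_∣_; divides; ∣-refl; ∣-trans; m∣m*n; m≤n⇒m!∣n!; m%n≡0⇒n∣m)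
open import Data.Nat.Coprimality using (Coprime; 1-coprimeTo; coprime-+)
import Data.Nat.Coprimality as Coprimality
open import Relation.Binary.Definitions using (tri<; tri≈; tri>)
open import Relation.Binary.PropositionalEquality as ≡ using (_≡_; refl; cong)
open import Relation.Nullary using (¬_; contradiction)
open import Relation.Nullary.Decidable using (decidable-stable; _⊎-dec_)
open import Algebra.Bundles using (Group)

¬¬-leastPositive : ∀ {p} (P : ℕ → Set p) {N} → 0 < N → P N →
  ¬ ¬ (∃[ m ] (0 < m × P m × (∀ j → 0 < j → j < m → ¬ P j)))
¬¬-leastPositive P {N} 0<N pN ¬least = noneBelow (suc N) N 0<N (n<1+n N) pN
  where
  noneBelow : ∀ n j → 0 < j → j < n → ¬ P j
  noneBelow (suc n) j 0<j j<1+n with m<1+n⇒m<n∨m≡n j<1+n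
  ... | inj₁ j<n  = noneBelow n j 0<j j<n
  ... | inj₂ refl = λ pj → ¬least (j , 0<j , pj , noneBelow j)

coprime-pred : ∀ {n} → 0 < n → Coprime (n ∸ 1) n
coprime-pred {suc n} _ = ≡.subst (Coprime n) (+-comm n 1) (Coprimality.sym (coprime-+ (1-coprimeTo n)))

coprime-2⇒%2≡1 : ∀ k → Coprime k 2 → k % 2 ≡ 1
coprime-2⇒%2≡1 k cop with k % 2 in eq | m%n<n k 2
... | 0           | _ = contradiction (cop (m%n≡0⇒n∣m k 2 eq , ∣-refl)) λ ()
... | 1           | _ = refl
... | suc (suc _) | s≤s (s≤s ())

module GroupProperties {c ℓ : Level} (H : Group c ℓ) where
  open Group H renaming (refl to ≈-refl)
  open import Algebra.Properties.Group H using (∙-cancelˡ; inverseʳ-unique; ε⁻¹≈ε)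
  open import Relation.Binary.Reasoning.Setoid setoid

  infixr 8 _^_
  _^_ : Carrier → ℕ → Carrier
  _^_ = pow H

  ^-+ : ∀ x a b → x ^ (a + b) ≈ x ^ a ∙ x ^ b
  ^-+ x zero    b = sym (identityˡ _)
  ^-+ x (suc a) b = trans (∙-congˡ (^-+ x a b)) (sym (assoc _ _ _))

  ^≈ε⇒^-multiple≈ε : ∀ {x d N} → x ^ d ≈ ε → d ∣ N → x ^ N ≈ ε
  ^≈ε⇒^-multiple≈ε {x} {d} x^d≈ε (divides q refl) = multiple q
    where
    multiple : ∀ q → x ^ (q * d) ≈ ε
    multiple zero    = ≈-refl
    multiple (suc q) = begin
      x ^ (d + q * d)      ≈⟨ ^-+ x d (q * d) ⟩
      x ^ d ∙ x ^ (q * d)  ≈⟨ ∙-cong x^d≈ε (multiple q) ⟩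
      ε ∙ ε                ≈⟨ identityˡ ε ⟩
      ε                    ∎

  ^-% : ∀ {x o} k .{{_ : NonZero o}} → x ^ o ≈ ε → x ^ k ≈ x ^ (k % o)
  ^-% {x} {o} k x^o≈ε = begin
    x ^ k                          ≡⟨ cong (x ^_) (m≡m%n+[m/n]*n k o) ⟩
    x ^ (k % o + k / o * o)        ≈⟨ ^-+ x (k % o) (k / o * o) ⟩
    x ^ (k % o) ∙ x ^ (k / o * o)  ≈⟨ ∙-congˡ (^≈ε⇒^-multiple≈ε x^o≈ε (divides (k / o) refl)) ⟩
    x ^ (k % o) ∙ ε                ≈⟨ identityʳ _ ⟩
    x ^ (k % o)                    ∎

  ^-pred : ∀ {x m} → 0 < m → x ^ m ≈ ε → x ^ (m ∸ 1) ≈ x ⁻¹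
  ^-pred {x} {suc m} _ = inverseʳ-unique x (x ^ m)

  ^-period : ∀ {x a b} → a ≤ b → x ^ a ≈ x ^ b → x ^ (b ∸ a) ≈ ε
  ^-period {x} {a} {b} a≤b x^a≈x^b = sym (∙-cancelˡ (x ^ a) ε (x ^ (b ∸ a)) (begin
    x ^ a ∙ ε            ≈⟨ identityʳ _ ⟩
    x ^ a                ≈⟨ x^a≈x^b ⟩
    x ^ b                ≡⟨ cong (x ^_) (≡.sym (m+[n∸m]≡n a≤b)) ⟩
    x ^ (a + (b ∸ a))    ≈⟨ ^-+ x a (b ∸ a) ⟩
    x ^ a ∙ x ^ (b ∸ a)  ∎))

  ^-distinct : ∀ {x o a b} → IsOrder H x o → a < b → b < o → ¬ x ^ a ≈ x ^ b
  ^-distinct {a = a} {b} (_ , _ , minimal) a<b b<o x^a≈x^b =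
    minimal (b ∸ a) (m<n⇒0<n∸m a<b) (≤-<-trans (m∸n≤m b a) b<o) (^-period (<⇒≤ a<b) x^a≈x^b)

  ^-injective-below-order : ∀ {x o a b} → IsOrder H x o → a < o → b < o → x ^ a ≈ x ^ b → a ≡ b
  ^-injective-below-order {a = a} {b} ord a<o b<o x^a≈x^b with <-cmp a b
  ... | tri≈ _ a≡b _ = a≡b
  ... | tri< a<b _ _ = contradiction x^a≈x^b (^-distinct ord a<b b<o)
  ... | tri> _ _ b<a = contradiction (sym x^a≈x^b) (^-distinct ord b<a a<o)

  finite⇒bounded-period : ((n , _) : IsFinite H) → ∀ x → ∃[ d ] (0 < d × d ≤ n × x ^ d ≈ ε)
  finite⇒bounded-period (n , enum , onto) x
    with i , j , i<j , same ← pigeonhole (n<1+n n) (λ i → proj₁ (onto (x ^ toℕ i))) =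
    toℕ j ∸ toℕ i , m<n⇒0<n∸m i<j , ≤-trans (m∸n≤m (toℕ j) (toℕ i)) (toℕ≤pred[n] j) ,
    ^-period (<⇒≤ i<j)
      (trans (sym (proj₂ (onto _))) (trans (reflexive (cong enum same)) (proj₂ (onto _))))

  ¬¬-exponent : IsFinite H → ¬ ¬ (∃ (IsExponent H))
  ¬¬-exponent fin@(n , _) = ¬¬-leastPositive (λ j → ∀ g → g ^ j ≈ ε) (1≤n! n) annihilates
    where
    annihilates : ∀ g → g ^ (n !) ≈ ε
    annihilates g with suc d , _ , d≤n , g^d≈ε ← finite⇒bounded-period fin g =
      ^≈ε⇒^-multiple≈ε g^d≈ε (∣-trans (m∣m*n {suc d} (d !)) (m≤n⇒m!∣n! d≤n))

  Conj-reflexive : ∀ {x y} → x ≈ y → Conj H x y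
  Conj-reflexive x≈y = ε , trans (∙-cong (identityˡ _) ε⁻¹≈ε) (trans (identityʳ _) x≈y)

  Conj-respˡ : ∀ {x x′ y} → x ≈ x′ → Conj H x y → Conj H x′ y
  Conj-respˡ x≈x′ (h , conj) = h , trans (∙-congʳ (∙-congˡ (sym x≈x′))) conj

  AtomWithin-respʳ : ∀ {g y y′} → y ≈ y′ → AtomWithin H g y → AtomWithin H g y′
  AtomWithin-respʳ y≈y′ within o ord k cop = Sum.map₂ (Conj-respˡ y≈y′) (within o ord k cop)

  inverseSemiRational⇒semiRational : InverseSemiRational H → SemiRational H
  inverseSemiRational⇒semiRational isr m (0<m , annihilates , _) g =
    m ∸ 1 , coprime-pred 0<m , AtomWithin-respʳ (sym (^-pred 0<m (annihilates g))) (isr g)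

  Conj-central⇒≈ : ∀ {z y} → IsCentral H z → Conj H z y → z ≈ y
  Conj-central⇒≈ {z} {y} central (h , conj) = begin
    z                ≈⟨ identityʳ z ⟨
    z ∙ ε            ≈⟨ ∙-congˡ (inverseʳ h) ⟨
    z ∙ (h ∙ h ⁻¹)   ≈⟨ assoc z h (h ⁻¹) ⟨
    (z ∙ h) ∙ h ⁻¹   ≈⟨ ∙-congʳ (central h) ⟩
    (h ∙ z) ∙ h ⁻¹   ≈⟨ conj ⟩
    y                ∎

  ^-central : ∀ {z} → IsCentral H z → ∀ n → IsCentral H (z ^ n)
  ^-central central zero    x = trans (identityˡ x) (sym (identityʳ x))
  ^-central {z} central (suc n) x = begin
    (z ∙ z ^ n) ∙ x  ≈⟨ assoc z (z ^ n) x ⟩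
    z ∙ (z ^ n ∙ x)  ≈⟨ ∙-congˡ (^-central central n x) ⟩
    z ∙ (x ∙ z ^ n)  ≈⟨ assoc z x (z ^ n) ⟨
    (z ∙ x) ∙ z ^ n  ≈⟨ ∙-congʳ (central x) ⟩
    (x ∙ z) ∙ z ^ n  ≈⟨ assoc x z (z ^ n) ⟩
    x ∙ (z ∙ z ^ n)  ∎

  central-atom : ∀ {x y o} → IsCentral H x → IsCentral H y → AtomWithin H x y → IsOrder H x o →
    ∀ k → Coprime k o → x ≈ x ^ k ⊎ y ≈ x ^ k
  central-atom cx cy within ord k cop =
    Sum.map (Conj-central⇒≈ cx) (Conj-central⇒≈ cy) (within _ ord k cop)

  central-atom-residue : ∀ {x y o} → IsCentral H x → IsCentral H y → AtomWithin H x y →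
    IsOrder H x (suc o) → ∀ k → Coprime k (suc o) → k % suc o ≡ 1 ⊎ k % suc o ≡ o
  central-atom-residue {o = zero} _ _ _ _ k _ = inj₂ (n%1≡0 k)
  central-atom-residue {x} {y} {suc o} cx cy within ord@(_ , x^o≈ε , _) k cop
    with central-atom cx cy within ord k cop
       | central-atom cx cy within ord (suc o) (coprime-pred (s≤s z≤n))
  ... | inj₁ x≈x^k | _ = inj₁ (^-injective-below-order ord (m%n<n k _) (s≤s (s≤s z≤n))
          (trans (sym (^-% k x^o≈ε)) (trans (sym x≈x^k) (sym (identityʳ x)))))
  ... | inj₂ y≈x^k | inj₂ y≈x^o = inj₂ (^-injective-below-order ord (m%n<n k _) (n<1+n _)
          (trans (sym (^-% k x^o≈ε)) (trans (sym y≈x^k) y≈x^o)))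
  -- x ≈ x^(o-1) = x⁻¹ forces o = 2, and then k is odd.
  ... | inj₂ _ | inj₁ x≈x^o
    with ^-injective-below-order ord (n<1+n _) (s≤s (s≤s z≤n)) (trans (sym x≈x^o) (sym (identityʳ x)))
  ... | refl = inj₁ (coprime-2⇒%2≡1 k cop)

  semiRational⇒central-residue : IsFinite H → SemiRational H → ∀ {x o} → IsCentral H x →
    IsOrder H x (suc o) → ∀ k → Coprime k (suc o) → k % suc o ≡ 1 ⊎ k % suc o ≡ o
  semiRational⇒central-residue fin sr {x} {o} cx ord k cop =
    decidable-stable (k % suc o ≟ 1 ⊎-dec k % suc o ≟ o) λ ¬residue →
      ¬¬-exponent fin λ (m , exponent) → let r , _ , within = sr m exponent x in
        ¬residue (central-atom-residue cx (^-central cx r) within ord k cop)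

  semiRational⇒central-atomWithin-inverse : IsFinite H → SemiRational H →
    ∀ {x} → IsCentral H x → AtomWithin H x (x ⁻¹)
  semiRational⇒central-atomWithin-inverse fin sr cx zero (() , _)
  semiRational⇒central-atomWithin-inverse fin sr {x} cx (suc o) ord@(_ , x^o≈ε , _) k cop
    with semiRational⇒central-residue fin sr cx ord k cop
  ... | inj₁ k%o≡1 = inj₁ (Conj-reflexive (begin
    x                  ≈⟨ identityʳ x ⟨
    x ^ 1              ≡⟨ cong (x ^_) k%o≡1 ⟨
    x ^ (k % suc o)    ≈⟨ ^-% k x^o≈ε ⟨
    x ^ k              ∎))
  ... | inj₂ k%o≡o = inj₂ (Conj-reflexive (begin
    x ⁻¹               ≈⟨ ^-pred {m = suc o} (s≤s z≤n) x^o≈ε ⟨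
    x ^ o              ≡⟨ cong (x ^_) k%o≡o ⟨
    x ^ (k % suc o)    ≈⟨ ^-% k x^o≈ε ⟨
    x ^ k              ∎))

module _ {c ℓ : Level} (G : Group c ℓ) where
  open Group G renaming (refl to ≈-refl)
  open GroupProperties G
  private
    module Z = Group (Centre G)
    module ZP = GroupProperties (Centre G)

  ^-Centre : ∀ z k → proj₁ (z ZP.^ k) ≈ proj₁ z ^ k
  ^-Centre z zero    = ≈-refl
  ^-Centre z (suc k) = ∙-congˡ (^-Centre z k)

  IsOrder-Centre : ∀ {z o} → IsOrder (Centre G) z o → IsOrder G (proj₁ z) o
  IsOrder-Centre {z} {o} (0<o , z^o≈ε , minimal) =
    0<o , trans (sym (^-Centre z o)) z^o≈ε ,
    λ j 0<j j<o z^j≈ε → minimal j 0<j j<o (trans (^-Centre z j) z^j≈ε)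

  Conj-Centre : ∀ g y k → Conj G (proj₁ y) (proj₁ g ^ k) → Conj (Centre G) y (g ZP.^ k)
  Conj-Centre g y k conj =
    ZP.Conj-reflexive {y} {g ZP.^ k} (trans (Conj-central⇒≈ (proj₂ y) conj) (sym (^-Centre g k)))

  AtomWithin-Centre : ∀ g y → AtomWithin G (proj₁ g) (proj₁ y) → AtomWithin (Centre G) g y
  AtomWithin-Centre g y within o ord k cop =
    Sum.map (Conj-Centre g g k) (Conj-Centre g y k) (within o (IsOrder-Centre ord) k cop)

  Rational-Centre : Rational G → Rational (Centre G)
  Rational-Centre rational g o ord k cop =
    Conj-Centre g g k (rational (proj₁ g) o (IsOrder-Centre ord) k cop)

  InverseSemiRational-Centre : InverseSemiRational G → InverseSemiRational (Centre G)
  InverseSemiRational-Centre isr g = AtomWithin-Centre g (g Z.⁻¹) (isr (proj₁ g))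

  SemiRational-Centre : IsFinite G → SemiRational G → SemiRational (Centre G)
  SemiRational-Centre fin sr = ZP.inverseSemiRational⇒semiRational λ g →
    AtomWithin-Centre g (g Z.⁻¹) (semiRational⇒central-atomWithin-inverse fin sr (proj₂ g))

mainTheorem4 : {c ℓ : Level} (G : Group c ℓ) → IsFinite G →
    (SemiRational G → SemiRational (Centre G))
    × (InverseSemiRational G → InverseSemiRational (Centre G))
    × (Rational G → Rational (Centre G))
mainTheorem4 G fin = SemiRational-Centre G fin , InverseSemiRational-Centre G , Rational-Centre G
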